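{- For all integers $a,b\geq 1$ there exists an $SMR(4b,2b(4a+3);4a+3,2)$.
   Context: A signed magic rectangle $SMR(m,n;r,s)$ is an $m\times n$ array, some of whose cells are filled with integers and the others empty, such that exactly $r$ cells in every row and exactly $s$ cells in every column are filled (so $mr=ns$), every element of $X$ appears exactly once in the array, and the sum of the entries of each row and of each column is zero, where (for $mr$ even) $X=\{\pm1,\pm2,\ldots,\pm mr/2\}$. -}

module Defs where

import Data.Nat
open import Data.Nat using (ℕ; zero; suc; _*_; _≤_; _/_)
open import Data.Integer as ℤ using (ℤ; +_; -_; ∣_∣; 0ℤ)
open import Data.Fin using (Fin)
open import Data.Maybe using (Maybe; just; nothing)
open import Data.List using (List; foldr; allFin; map)
open import Data.Product using (_×_; Σ; _,_)
open import Relation.Binary.PropositionalEquality using (_≡_)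
open import Relation.Nullary using (yes; no)

PArray : ℕ → ℕ → Set
PArray m n = Fin m → Fin n → Maybe ℤ

filled : Maybe ℤ → ℕ
filled (just _) = 1
filled nothing  = 0

val : Maybe ℤ → ℤ
val (just x) = x
val nothing  = 0ℤ

Σℕ : (k : ℕ) → (Fin k → ℕ) → ℕ
Σℕ k f = foldr Data.Nat._+_ 0 (map f (allFin k))

Σℤ : (k : ℕ) → (Fin k → ℤ) → ℤ
Σℤ k f = foldr ℤ._+_ 0ℤ (map f (allFin k))

occurrences : ∀ {m n} → PArray m n → ℤ → ℕ
occurrences {m} {n} A x = Σℕ m (λ i → Σℕ n (λ j → hit (A i j)))
  where
  hit : Maybe ℤ → ℕ
  hit nothing = 0
  hit (just y) with y ℤ.≟ x
  ... | yes _ = 1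
  ... | no  _ = 0

InX : ℕ → ℤ → Set
InX k x = (1 ≤ ∣ x ∣) × (∣ x ∣ ≤ k)

record IsSMR (m n r s : ℕ) (A : PArray m n) : Set where
  field
    rowCount  : ∀ i → Σℕ n (λ j → filled (A i j)) ≡ r
    colCount  : ∀ j → Σℕ m (λ i → filled (A i j)) ≡ s
    entriesInX : ∀ i j x → A i j ≡ just x → InX ((m * r) / 2) x
    eachOnce  : ∀ x → InX ((m * r) / 2) x → occurrences A x ≡ 1
    rowSum    : ∀ i → Σℤ n (λ j → val (A i j)) ≡ 0ℤ
    colSum    : ∀ j → Σℤ m (λ i → val (A i j)) ≡ 0ℤ

SMR : ℕ → ℕ → ℕ → ℕ → Set
SMR m n r s = Σ (PArray m n) (IsSMR m n r s)

module Submission where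

-- Column c carries the entries c + 1 and -(c + 1), in two different rows; this settles the column
-- conditions and the requirement that each element of X occurs exactly once, and leaves only the row
-- counts and row sums. The 4b rows form b blocks of four. The columns are cut into segments whose
-- strands visit every block exactly once, in forward or reverse order, so the entry a strand puts
-- into block t is an affine function of the first column B of the segment, of t and of b - 1 - t. Each
-- row sum therefore becomes an identity between linear polynomials in B, t and b - 1 - t; for the
-- two fixed templates (a core of width 14b and a quad of width 8b, repeated a - 1 times) these
-- identities are checked by the normaliser of the semiring solver. Counting entries row by row
-- gives 7 + 4(a - 1) = 4a + 3.

open import Defs
open import Data.Bool using (Bool; true; false; if_then_else_)
open import Data.Bool.Properties using (T-≡; ¬-not)
open import Data.Empty using (⊥-elim)
open import Data.Fin as Fin using (Fin; toℕ)
open import Data.Fin.Properties using (toℕ<n)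
open import Data.Integer as ℤ using (ℤ; 0ℤ; _◃_)
import Data.Integer.Properties as ℤ
import Data.Integer.Tactic.RingSolver as ℤ-Solver
open import Data.List using (List; []; _∷_; _++_; map; allFin; foldr; concat; replicate)
open import Data.List.Properties using (map-tabulate; map-cong)
open import Data.List.Relation.Unary.All using (All; []; _∷_; all?)
import Data.List.Relation.Unary.All.Properties as All
open import Data.Maybe using (Maybe; just; nothing)
open import Data.Maybe.Properties using (just-injective)
open import Data.Nat
open import Data.Nat.DivMod
  using (_/_; _%_; m<n⇒m%n≡m; [m+kn]%n≡m%n; m≡m%n+[m/n]*n; m%n<n; m<n*o⇒m/o<n; m*n/n≡m)
open import Data.Nat.ListAction using (sum)
open import Data.Nat.Properties
open import Data.Nat.Solver using (module +-*-Solver)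
open import Data.Nat.Tactic.RingSolver using (solve-∀)
open import Algebra.Properties.CommutativeSemigroup +-commutativeSemigroup using (interchange; x∙yz≈y∙xz)
open import Data.Product using (_×_; _,_; proj₁; proj₂)
open import Data.Sign using (Sign)
open import Data.Vec using (Vec; _∷_; [])
open import Function using (id; _∘_; Equivalence)
open import Relation.Binary.PropositionalEquality
open import Relation.Nullary using (¬?; Dec; does; yes; no)
open import Relation.Nullary.Decidable using (dec-true; dec-false; _×-dec_; toWitness)

-- Finite sums

∑ : ℕ → (ℕ → ℕ) → ℕ
∑ zero    f = 0
∑ (suc k) f = f 0 + ∑ k (f ∘ suc)

∑-cong : ∀ k {f g : ℕ → ℕ} → (∀ i → i < k → f i ≡ g i) → ∑ k f ≡ ∑ k g
∑-cong zero    f≗g = refl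
∑-cong (suc k) f≗g = cong₂ _+_ (f≗g 0 z<s) (∑-cong k (λ i i<k → f≗g (suc i) (s<s i<k)))

∑-zero : ∀ k {f : ℕ → ℕ} → (∀ i → i < k → f i ≡ 0) → ∑ k f ≡ 0
∑-zero zero    f≗0 = refl
∑-zero (suc k) f≗0 = cong₂ _+_ (f≗0 0 z<s) (∑-zero k (λ i i<k → f≗0 (suc i) (s<s i<k)))

∑-distrib-+ : ∀ k (f g : ℕ → ℕ) → ∑ k (λ i → f i + g i) ≡ ∑ k f + ∑ k g
∑-distrib-+ zero    f g = refl
∑-distrib-+ (suc k) f g = begin
  (f 0 + g 0) + ∑ k (λ i → f (suc i) + g (suc i))
    ≡⟨ cong (f 0 + g 0 +_) (∑-distrib-+ k (f ∘ suc) (g ∘ suc)) ⟩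
  (f 0 + g 0) + (∑ k (f ∘ suc) + ∑ k (g ∘ suc))
    ≡⟨ interchange (f 0) (g 0) _ _ ⟩
  (f 0 + ∑ k (f ∘ suc)) + (g 0 + ∑ k (g ∘ suc)) ∎
  where open ≡-Reasoning

∑-+ : ∀ k l (f : ℕ → ℕ) → ∑ (k + l) f ≡ ∑ k f + ∑ l (λ i → f (k + i))
∑-+ zero    l f = refl
∑-+ (suc k) l f = trans (cong (f 0 +_) (∑-+ k l (f ∘ suc))) (sym (+-assoc (f 0) _ _))

∑-*2 : ∀ k (f : ℕ → ℕ) → ∑ (k * 2) f ≡ ∑ k (λ i → f (i * 2)) + ∑ k (λ i → f (suc (i * 2)))
∑-*2 zero    f = refl
∑-*2 (suc k) f = begin
  f 0 + (f 1 + ∑ (k * 2) (f ∘ suc ∘ suc))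
    ≡⟨ cong (λ s → f 0 + (f 1 + s)) (∑-*2 k (f ∘ suc ∘ suc)) ⟩
  f 0 + (f 1 + (evens + odds))
    ≡⟨ cong (f 0 +_) (x∙yz≈y∙xz (f 1) evens odds) ⟩
  f 0 + (evens + (f 1 + odds))
    ≡⟨ sym (+-assoc (f 0) evens _) ⟩
  (f 0 + evens) + (f 1 + odds) ∎
  where
  open ≡-Reasoning
  evens odds : ℕ
  evens = ∑ k (λ i → f (suc i * 2))
  odds  = ∑ k (λ i → f (suc (suc i * 2)))

∑-comm : ∀ k l (f : ℕ → ℕ → ℕ) → ∑ k (λ i → ∑ l (f i)) ≡ ∑ l (λ j → ∑ k (λ i → f i j))
∑-comm zero    l f = sym (∑-zero l {λ _ → 0} (λ _ _ → refl))
∑-comm (suc k) l f = trans (cong (∑ l (f 0) +_) (∑-comm k l (f ∘ suc))) (sym (∑-distrib-+ l (f 0) _))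

∑-single : ∀ k p {f : ℕ → ℕ} → p < k → (∀ i → i < k → i ≢ p → f i ≡ 0) → ∑ k f ≡ f p
∑-single (suc k) zero {f} _ others = begin
  f 0 + ∑ k (f ∘ suc) ≡⟨ cong (f 0 +_) (∑-zero k (λ i i<k → others (suc i) (s<s i<k) λ ())) ⟩
  f 0 + 0             ≡⟨ +-identityʳ (f 0) ⟩
  f 0                 ∎
  where open ≡-Reasoning
∑-single (suc k) (suc p) (s<s p<k) others =
  cong₂ _+_ (others 0 z<s λ ())
            (∑-single k p p<k λ i i<k i≢p → others (suc i) (s<s i<k) (i≢p ∘ suc-injective))

map-allFin-suc : ∀ {A : Set} k (F : Fin (suc k) → A) →
  map F (allFin (suc k)) ≡ F Fin.zero ∷ map (F ∘ Fin.suc) (allFin k)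
map-allFin-suc k F =
  cong (F Fin.zero ∷_) (trans (map-tabulate Fin.suc F) (sym (map-tabulate id (F ∘ Fin.suc))))

Σℕ-toℕ : ∀ k (F : ℕ → ℕ) → Σℕ k (F ∘ toℕ) ≡ ∑ k F
Σℕ-toℕ zero    F = refl
Σℕ-toℕ (suc k) F = begin
  foldr _+_ 0 (map (F ∘ toℕ) (allFin (suc k))) ≡⟨ cong (foldr _+_ 0) (map-allFin-suc k (F ∘ toℕ)) ⟩
  F 0 + Σℕ k (F ∘ suc ∘ toℕ)                   ≡⟨ cong (F 0 +_) (Σℕ-toℕ k (F ∘ suc)) ⟩
  F 0 + ∑ k (F ∘ suc)                          ∎
  where open ≡-Reasoning

Σℤ-difference : ∀ k (f g : ℕ → ℕ) →
  Σℤ k (λ i → ℤ.+ f (toℕ i) ℤ.- ℤ.+ g (toℕ i)) ≡ ℤ.+ ∑ k f ℤ.- ℤ.+ ∑ k g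
Σℤ-difference zero    f g = refl
Σℤ-difference (suc k) f g = begin
  foldr ℤ._+_ 0ℤ (map d (allFin (suc k)))
    ≡⟨ cong (foldr ℤ._+_ 0ℤ) (map-allFin-suc k d) ⟩
  d Fin.zero ℤ.+ Σℤ k (d ∘ Fin.suc)
    ≡⟨ cong (λ z → d Fin.zero ℤ.+ z) (Σℤ-difference k (f ∘ suc) (g ∘ suc)) ⟩
  (ℤ.+ f 0 ℤ.- ℤ.+ g 0) ℤ.+ (ℤ.+ ∑ k (f ∘ suc) ℤ.- ℤ.+ ∑ k (g ∘ suc))
    ≡⟨ differences (ℤ.+ f 0) (ℤ.+ g 0) (ℤ.+ ∑ k (f ∘ suc)) (ℤ.+ ∑ k (g ∘ suc)) ⟩
  (ℤ.+ f 0 ℤ.+ ℤ.+ ∑ k (f ∘ suc)) ℤ.- (ℤ.+ g 0 ℤ.+ ℤ.+ ∑ k (g ∘ suc)) ∎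
  where
  open ≡-Reasoning
  d : Fin (suc k) → ℤ
  d i = ℤ.+ f (toℕ i) ℤ.- ℤ.+ g (toℕ i)
  differences : ∀ p q p′ q′ → (p ℤ.- q) ℤ.+ (p′ ℤ.- q′) ≡ (p ℤ.+ p′) ℤ.- (q ℤ.+ q′)
  differences = ℤ-Solver.solve-∀

Σℕ-cong : ∀ k {f g : Fin k → ℕ} → (∀ i → f i ≡ g i) → Σℕ k f ≡ Σℕ k g
Σℕ-cong k f≗g = cong (foldr _+_ 0) (map-cong f≗g (allFin k))

Σℤ-cong : ∀ k {f g : Fin k → ℤ} → (∀ i → f i ≡ g i) → Σℤ k f ≡ Σℤ k g
Σℤ-cong k f≗g = cong (foldr ℤ._+_ 0ℤ) (map-cong f≗g (allFin k))

≡ᵇ-true : ∀ {i j} → i ≡ j → (i ≡ᵇ j) ≡ true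
≡ᵇ-true {i} {j} = dec-true (i ≟ j)

≡ᵇ-false : ∀ {i j} → i ≢ j → (i ≡ᵇ j) ≡ false
≡ᵇ-false {i} {j} = dec-false (i ≟ j)

≡ᵇ-true⁻¹ : ∀ i j → (i ≡ᵇ j) ≡ true → i ≡ j
≡ᵇ-true⁻¹ i j = ≡ᵇ⇒≡ i j ∘ Equivalence.from T-≡

<ᵇ-true : ∀ {i j} → i < j → (i <ᵇ j) ≡ true
<ᵇ-true = Equivalence.to T-≡ ∘ <⇒<ᵇ

<ᵇ-false : ∀ {i j} → j ≤ i → (i <ᵇ j) ≡ false
<ᵇ-false {i} {j} j≤i = ¬-not λ i<ᵇj → <⇒≱ (<ᵇ⇒< i j (Equivalence.from T-≡ i<ᵇj)) j≤i

δ : ℕ → ℕ → ℕ → ℕ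
δ i j a = if i ≡ᵇ j then a else 0

δ-≡ : ∀ {i j} a → i ≡ j → δ i j a ≡ a
δ-≡ a i≡j rewrite ≡ᵇ-true i≡j = refl

δ-≢ : ∀ {i j} a → i ≢ j → δ i j a ≡ 0
δ-≢ a i≢j rewrite ≡ᵇ-false i≢j = refl

∑-δ : ∀ k {p} a → p < k → ∑ k (λ i → δ i p a) ≡ a
∑-δ k {p} a p<k = trans (∑-single k p p<k (λ i _ i≢p → δ-≢ a i≢p)) (δ-≡ {p} a refl)

∑-δ-factor : ∀ k p q (f : ℕ → ℕ) → ∑ k (λ i → δ p q (f i)) ≡ δ p q (∑ k f)
∑-δ-factor k p q f with p ≟ q
... | yes p≡q = trans (∑-cong k (λ i _ → δ-≡ (f i) p≡q)) (sym (δ-≡ (∑ k f) p≡q))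
... | no  p≢q = trans (∑-zero k (λ i _ → δ-≢ (f i) p≢q)) (sym (δ-≢ (∑ k f) p≢q))

∑-δ-involution : ∀ k {g : ℕ → ℕ} →
  (∀ {i} → i < k → g i < k) → (∀ {i} → i < k → g (g i) ≡ i) →
  ∀ {t} (f : ℕ → ℕ) → t < k → ∑ k (λ i → δ t (g i) (f i)) ≡ f (g t)
∑-δ-involution k {g} g<k g∘g≗id {t} f t<k =
  trans (∑-single k (g t) (g<k t<k) (λ i i<k i≢gt → δ-≢ (f i) (i≢gt ∘ moved i<k)))
        (δ-≡ (f (g t)) (sym (g∘g≗id t<k)))
  where
  moved : ∀ {i} → i < k → t ≡ g i → i ≡ g t
  moved {i} i<k t≡gi = trans (sym (g∘g≗id i<k)) (cong g (sym t≡gi))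

+-*-injective : ∀ {h} .{{_ : NonZero h}} {ρ r} t u → ρ < h → r < h →
  ρ + t * h ≡ r + u * h → ρ ≡ r × t ≡ u
+-*-injective {h} {ρ} {r} t u ρ<h r<h eq =
  ρ≡r , *-cancelʳ-≡ t u h (+-cancelˡ-≡ ρ _ _ (trans eq (cong (_+ u * h) (sym ρ≡r))))
  where
  remainder : ∀ {i} q → i < h → (i + q * h) % h ≡ i
  remainder {i} q i<h = trans ([m+kn]%n≡m%n i q h) (m<n⇒m%n≡m i<h)
  ρ≡r : ρ ≡ r
  ρ≡r = trans (sym (remainder t ρ<h)) (trans (cong (_% h) eq) (remainder u r<h))

δ-digits : ∀ {h} .{{_ : NonZero h}} {ρ r} t u a → ρ < h → r < h →
  δ (ρ + t * h) (r + u * h) a ≡ δ ρ r (δ t u a)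
δ-digits {ρ = ρ} {r} t u a ρ<h r<h with ρ ≟ r | t ≟ u
... | yes refl | yes refl = trans (δ-≡ {ρ + t * _} a refl) (sym (trans (δ-≡ {ρ} _ refl) (δ-≡ {t} a refl)))
... | yes refl | no t≢u   =
  trans (δ-≢ a (t≢u ∘ proj₂ ∘ +-*-injective t u ρ<h r<h)) (sym (trans (δ-≡ {ρ} _ refl) (δ-≢ a t≢u)))
... | no ρ≢r   | _        = trans (δ-≢ a (ρ≢r ∘ proj₁ ∘ +-*-injective t u ρ<h r<h)) (sym (δ-≢ _ ρ≢r))

alternate : {A : Set} → A → A → ℕ → A
alternate u v zero    = u
alternate u v (suc j) = alternate v u j

alternate-even : ∀ {A : Set} (u v : A) i → alternate u v (i * 2) ≡ u
alternate-even u v zero    = refl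
alternate-even u v (suc i) = alternate-even u v i

alternate-odd : ∀ {A : Set} (u v : A) i → alternate u v (suc (i * 2)) ≡ v
alternate-odd u v = alternate-even v u

alternate-preserves : ∀ {A : Set} {P : A → Set} {u v} → P u → P v → ∀ j → P (alternate u v j)
alternate-preserves             pu pv zero    = pu
alternate-preserves {P = P} pu pv (suc j) = alternate-preserves {P = P} pv pu j

⌊i*2/2⌋≡i : ∀ i → ⌊ i * 2 /2⌋ ≡ i
⌊i*2/2⌋≡i zero    = refl
⌊i*2/2⌋≡i (suc i) = cong suc (⌊i*2/2⌋≡i i)

⌊1+i*2/2⌋≡i : ∀ i → ⌊ suc (i * 2) /2⌋ ≡ i
⌊1+i*2/2⌋≡i zero    = refl
⌊1+i*2/2⌋≡i (suc i) = cong suc (⌊1+i*2/2⌋≡i i)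

⌊j/2⌋<k : ∀ {j} k → j < k * 2 → ⌊ j /2⌋ < k
⌊j/2⌋<k {zero}        (suc k) _                = z<s
⌊j/2⌋<k {suc zero}    (suc k) _                = z<s
⌊j/2⌋<k {suc (suc j)} (suc k) (s<s (s<s j<2k)) = s<s (⌊j/2⌋<k k j<2k)

-- Arrays with the entries ±(c + 1) in column c

-- `occurrences` counts through a function local to its definition; a 1 × 1 array exposes it.
cellOccurrences : ℤ → Maybe ℤ → ℕ
cellOccurrences x y = occurrences {1} {1} (λ _ _ → y) x

cellOccurrences-just : ∀ x y → cellOccurrences x (just y) ≡ (if does (y ℤ.≟ x) then 1 else 0)
cellOccurrences-just x y with y ℤ.≟ x
... | yes _ = refl
... | no  _ = refl

entry : Sign → ℕ → ℤ
entry σ c = σ ◃ suc c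

columnOccurrences : ℤ → ℕ → ℕ
columnOccurrences x c = cellOccurrences x (just (entry Sign.+ c)) + cellOccurrences x (just (entry Sign.- c))

∑-columnOccurrences : ∀ n x → 1 ≤ ℤ.∣ x ∣ → ℤ.∣ x ∣ ≤ n → ∑ n (columnOccurrences x) ≡ 1
∑-columnOccurrences n x@(ℤ.+ suc j) _ j<n = trans (∑-cong n (λ c _ → onlyColumn c)) (∑-δ n 1 j<n)
  where
  onlyColumn : ∀ c → columnOccurrences x c ≡ δ c j 1
  onlyColumn c =
    trans (cong₂ _+_ (cellOccurrences-just x (ℤ.+ suc c)) (cellOccurrences-just x ℤ.-[1+ c ])) (+-identityʳ _)
∑-columnOccurrences n x@(ℤ.-[1+ j ]) _ j<n = trans (∑-cong n (λ c _ → onlyColumn c)) (∑-δ n 1 j<n)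
  where
  onlyColumn : ∀ c → columnOccurrences x c ≡ δ c j 1
  onlyColumn c = cong₂ _+_ (cellOccurrences-just x (ℤ.+ suc c)) (cellOccurrences-just x ℤ.-[1+ c ])

record ValidColumn (m : ℕ) (rows : Sign → ℕ) : Set where
  field
    bounded  : ∀ σ → rows σ < m
    distinct : rows Sign.+ ≢ rows Sign.-

IsPlacement : ℕ → ℕ → (ℕ → Sign → ℕ) → Set
IsPlacement m n place = ∀ {c} → c < n → ValidColumn m (place c)

module PairArray (m n : ℕ) (place : ℕ → Sign → ℕ) where

  cell : ℕ → ℕ → Maybe ℤ
  cell r c =
    if r ≡ᵇ place c Sign.+ then just (entry Sign.+ c) else
    if r ≡ᵇ place c Sign.- then just (entry Sign.- c) else nothing

  array : PArray m n
  array i j = cell (toℕ i) (toℕ j)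

  incidence : Sign → (ℕ → ℕ) → ℕ → ℕ
  incidence σ v r = ∑ n (λ c → δ r (place c σ) (v c))

  module _ (isPlacement : IsPlacement m n place) where
    private
      bounded : ∀ {c} σ → c < n → place c σ < m
      bounded σ c<n = ValidColumn.bounded (isPlacement c<n) σ

      distinct : ∀ {c} → c < n → place c Sign.+ ≢ place c Sign.-
      distinct c<n = ValidColumn.distinct (isPlacement c<n)

    cell-split : ∀ (f : Maybe ℤ → ℕ) → f nothing ≡ 0 → ∀ r {c} → c < n →
      f (cell r c) ≡ δ r (place c Sign.+) (f (just (entry Sign.+ c)))
                   + δ r (place c Sign.-) (f (just (entry Sign.- c)))
    cell-split f f∅≡0 r {c} c<n with r ≡ᵇ place c Sign.+ in r≡p | r ≡ᵇ place c Sign.- in r≡q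
    ... | true  | true  = ⊥-elim (distinct c<n (trans (sym (≡ᵇ-true⁻¹ r _ r≡p)) (≡ᵇ-true⁻¹ r _ r≡q)))
    ... | true  | false = sym (+-identityʳ _)
    ... | false | true  = refl
    ... | false | false = f∅≡0

    cell-value : ∀ r {c} → c < n →
      val (cell r c) ≡ ℤ.+ δ r (place c Sign.+) (suc c) ℤ.- ℤ.+ δ r (place c Sign.-) (suc c)
    cell-value r {c} c<n with r ≡ᵇ place c Sign.+ in r≡p | r ≡ᵇ place c Sign.- in r≡q
    ... | true  | true  = ⊥-elim (distinct c<n (trans (sym (≡ᵇ-true⁻¹ r _ r≡p)) (≡ᵇ-true⁻¹ r _ r≡q)))
    ... | true  | false = sym (ℤ.+-identityʳ _)
    ... | false | true  = sym (ℤ.+-identityˡ _)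
    ... | false | false = refl

    cell-magnitude : ∀ r c x → cell r c ≡ just x → ℤ.∣ x ∣ ≡ suc c
    cell-magnitude r c x cell≡x with r ≡ᵇ place c Sign.+ | r ≡ᵇ place c Sign.-
    ... | true  | _     = trans (cong ℤ.∣_∣ (sym (just-injective cell≡x))) (ℤ.abs-◃ Sign.+ (suc c))
    ... | false | true  = trans (cong ℤ.∣_∣ (sym (just-injective cell≡x))) (ℤ.abs-◃ Sign.- (suc c))
    ... | false | false with () ← cell≡x

    column-total : ∀ (f : Maybe ℤ → ℕ) → f nothing ≡ 0 → ∀ {c} → c < n →
      ∑ m (λ r → f (cell r c)) ≡ f (just (entry Sign.+ c)) + f (just (entry Sign.- c))
    column-total f f∅≡0 {c} c<n = begin
      ∑ m (λ r → f (cell r c))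
        ≡⟨ ∑-cong m (λ r _ → cell-split f f∅≡0 r c<n) ⟩
      ∑ m (λ r → δ r (place c Sign.+) f₊ + δ r (place c Sign.-) f₋)
        ≡⟨ ∑-distrib-+ m _ _ ⟩
      ∑ m (λ r → δ r (place c Sign.+) f₊) + ∑ m (λ r → δ r (place c Sign.-) f₋)
        ≡⟨ cong₂ _+_ (∑-δ m f₊ (bounded Sign.+ c<n)) (∑-δ m f₋ (bounded Sign.- c<n)) ⟩
      f₊ + f₋ ∎
      where
      open ≡-Reasoning
      f₊ f₋ : ℕ
      f₊ = f (just (entry Sign.+ c))
      f₋ = f (just (entry Sign.- c))

    column-sum : ∀ {c} → c < n → Σℤ m (λ i → val (cell (toℕ i) c)) ≡ 0ℤ
    column-sum {c} c<n = begin
      Σℤ m (λ i → val (cell (toℕ i) c))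
        ≡⟨ Σℤ-cong m (λ i → cell-value (toℕ i) c<n) ⟩
      Σℤ m (λ i → ℤ.+ δ (toℕ i) (place c Sign.+) (suc c) ℤ.- ℤ.+ δ (toℕ i) (place c Sign.-) (suc c))
        ≡⟨ Σℤ-difference m _ _ ⟩
      ℤ.+ ∑ m (λ r → δ r (place c Sign.+) (suc c)) ℤ.- ℤ.+ ∑ m (λ r → δ r (place c Sign.-) (suc c))
        ≡⟨ cong₂ (λ p q → ℤ.+ p ℤ.- ℤ.+ q) (∑-δ m (suc c) (bounded Sign.+ c<n))
                                           (∑-δ m (suc c) (bounded Sign.- c<n)) ⟩
      ℤ.+ suc c ℤ.- ℤ.+ suc c
        ≡⟨ ℤ.+-inverseʳ (ℤ.+ suc c) ⟩
      0ℤ ∎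
      where open ≡-Reasoning

    row-count : ∀ r →
      Σℕ n (λ j → filled (cell r (toℕ j))) ≡ incidence Sign.+ (λ _ → 1) r + incidence Sign.- (λ _ → 1) r
    row-count r = begin
      Σℕ n (λ j → filled (cell r (toℕ j)))
        ≡⟨ Σℕ-toℕ n (λ c → filled (cell r c)) ⟩
      ∑ n (λ c → filled (cell r c))
        ≡⟨ ∑-cong n (λ c c<n → cell-split filled refl r c<n) ⟩
      ∑ n (λ c → δ r (place c Sign.+) 1 + δ r (place c Sign.-) 1)
        ≡⟨ ∑-distrib-+ n _ _ ⟩
      incidence Sign.+ (λ _ → 1) r + incidence Sign.- (λ _ → 1) r ∎
      where open ≡-Reasoning

    row-sum : ∀ r →
      Σℤ n (λ j → val (cell r (toℕ j))) ≡ ℤ.+ incidence Sign.+ suc r ℤ.- ℤ.+ incidence Sign.- suc r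
    row-sum r = trans (Σℤ-cong n (λ j → cell-value r (toℕ<n j))) (Σℤ-difference n _ _)

    occurrences-array : ∀ x → InX n x → occurrences array x ≡ 1
    occurrences-array x (1≤∣x∣ , ∣x∣≤n) = begin
      occurrences array x
        ≡⟨ Σℕ-cong m (λ i → Σℕ-cong n (λ j → sym (trans (+-identityʳ _) (+-identityʳ _)))) ⟩
      Σℕ m (λ i → Σℕ n (λ j → cellOccurrences x (array i j)))
        ≡⟨ Σℕ-cong m (λ i → Σℕ-toℕ n (λ c → cellOccurrences x (cell (toℕ i) c))) ⟩
      Σℕ m (λ i → ∑ n (λ c → cellOccurrences x (cell (toℕ i) c)))
        ≡⟨ Σℕ-toℕ m (λ r → ∑ n (λ c → cellOccurrences x (cell r c))) ⟩
      ∑ m (λ r → ∑ n (λ c → cellOccurrences x (cell r c)))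
        ≡⟨ ∑-comm m n (λ r c → cellOccurrences x (cell r c)) ⟩
      ∑ n (λ c → ∑ m (λ r → cellOccurrences x (cell r c)))
        ≡⟨ ∑-cong n (λ c c<n → column-total (cellOccurrences x) refl c<n) ⟩
      ∑ n (columnOccurrences x)
        ≡⟨ ∑-columnOccurrences n x 1≤∣x∣ ∣x∣≤n ⟩
      1 ∎
      where open ≡-Reasoning

    isSMR : ∀ {k} → (m * k) / 2 ≡ n →
      (∀ r → r < m → incidence Sign.+ (λ _ → 1) r + incidence Sign.- (λ _ → 1) r ≡ k) →
      (∀ r → r < m → incidence Sign.+ suc r ≡ incidence Sign.- suc r) →
      IsSMR m n k 2 array
    isSMR half≡n counts balanced = record
      { rowCount   = λ i → trans (row-count (toℕ i)) (counts (toℕ i) (toℕ<n i))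
      ; colCount   = λ j → trans (Σℕ-toℕ m (λ r → filled (cell r (toℕ j))))
                                 (column-total filled refl (toℕ<n j))
      ; entriesInX = λ i j x cell≡x → subst (λ h → InX h x) (sym half≡n) (inX i j x cell≡x)
      ; eachOnce   = λ x x∈X → occurrences-array x (subst (λ h → InX h x) half≡n x∈X)
      ; rowSum     = λ i → trans (row-sum (toℕ i)) (row-balance (toℕ i) (toℕ<n i))
      ; colSum     = λ j → column-sum (toℕ<n j)
      }
      where
      inX : ∀ i j x → array i j ≡ just x → InX n x
      inX i j x cell≡x rewrite cell-magnitude (toℕ i) (toℕ j) x cell≡x = s≤s z≤n , toℕ<n j
      row-balance : ∀ r → r < m → ℤ.+ incidence Sign.+ suc r ℤ.- ℤ.+ incidence Sign.- suc r ≡ 0ℤ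
      row-balance r r<m rewrite balanced r r<m = ℤ.+-inverseʳ (ℤ.+ incidence Sign.- suc r)

-- Strands and segments

-- Column w of a strand holds its positive entry in row plusResidue and its negative entry in row
-- minusResidue of block w, or of block b - 1 - w if the strand is reversed.
record Strand : Set where
  constructor strand
  field
    reversed     : Bool
    plusResidue  : ℕ
    minusResidue : ℕ

forward backward : ℕ → ℕ → Strand
forward  = strand false
backward = strand true

residue : Sign → Strand → ℕ
residue Sign.+ = Strand.plusResidue
residue Sign.- = Strand.minusResidue

ValidStrand : Strand → Set
ValidStrand (strand _ p q) = p < 4 × q < 4 × p ≢ q

validStrand? : ∀ s → Dec (ValidStrand s)
validStrand? (strand _ p q) = p <? 4 ×-dec q <? 4 ×-dec ¬? (p ≟ q)

residue<4 : ∀ {s} → ValidStrand s → ∀ σ → residue σ s < 4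
residue<4 (p<4 , _   , _) Sign.+ = p<4
residue<4 (_   , q<4 , _) Sign.- = q<4

data Segment : Set where
  single : Strand → Segment
  double : Strand → Strand → Segment

ValidSegment : Segment → Set
ValidSegment (single s)    = ValidStrand s
ValidSegment (double s s′) = ValidStrand s × ValidStrand s′

validSegment? : ∀ seg → Dec (ValidSegment seg)
validSegment? (single s)    = validStrand? s
validSegment? (double s s′) = validStrand? s ×-dec validStrand? s′

segmentWidth : {A : Set} → (A → A) → A → Segment → A
segmentWidth twice b (single _)   = b
segmentWidth twice b (double _ _) = twice b

-- The sum of value c over the columns c, counted from B, whose entry of sign σ lies in row ρ of
-- block x; y stands for b - 1 - x. It is stated over any additive structure so that it can be
-- read both in ℕ and as a solver polynomial in B, x and y.
module Profile {A : Set} (_⊕_ : A → A → A) (𝟘 𝟙 : A) (twice : A → A)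
               (b x y : A) (value : A → A) (σ : Sign) (ρ : ℕ) where

  position : Strand → A
  position s = if Strand.reversed s then y else x

  onRow : Strand → A → A
  onRow s c = if ρ ≡ᵇ residue σ s then value c else 𝟘

  contribution : A → Segment → A
  contribution B (single s)    = onRow s (B ⊕ position s)
  contribution B (double s s′) = onRow s (B ⊕ twice (position s)) ⊕ onRow s′ (B ⊕ (𝟙 ⊕ twice (position s′)))

  profile : A → List Segment → A
  profile B []         = 𝟘
  profile B (seg ∷ ss) = contribution B seg ⊕ profile (B ⊕ segmentWidth twice b seg) ss

module ℕProfile (b x y : ℕ) (v : ℕ → ℕ) = Profile _+_ 0 1 (_* 2) b x y v

module Layout (b : ℕ) where

  block : Strand → ℕ → ℕ
  block s w = if Strand.reversed s then b ∸ suc w else w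

  placeStrand : Strand → ℕ → Sign → ℕ
  placeStrand s w σ = residue σ s + block s w * 4

  placeSegment : Segment → ℕ → Sign → ℕ
  placeSegment (single s)    w = placeStrand s w
  placeSegment (double s s′) j = placeStrand (alternate s s′ j) ⌊ j /2⌋

  width : Segment → ℕ
  width = segmentWidth (_* 2) b

  totalWidth : List Segment → ℕ
  totalWidth = sum ∘ map width

  place : List Segment → ℕ → Sign → ℕ
  place []         j = λ _ → 0
  place (seg ∷ ss) j = if j <ᵇ width seg then placeSegment seg j else place ss (j ∸ width seg)

  block<b : ∀ s {w} → w < b → block s w < b
  block<b (strand false _ _)     w<b       = w<b
  block<b (strand true  _ _) {w} (s<s w<b) = s<s (m∸n≤m _ w)

  block-involutive : ∀ s {w} → w < b → block s (block s w) ≡ w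
  block-involutive (strand false _ _) _         = refl
  block-involutive (strand true  _ _) (s<s w<b) = m∸[m∸n]≡n w<b

  placeStrand-valid : ∀ {s w} → ValidStrand s → w < b → ValidColumn (4 * b) (placeStrand s w)
  placeStrand-valid {s} {w} valid w<b = record
    { bounded  = λ σ → <-≤-trans (+-monoˡ-< (block s w * 4) (residue<4 valid σ)) block+1≤b
    ; distinct = proj₂ (proj₂ valid) ∘ +-cancelʳ-≡ _ _ _
    }
    where
    block+1≤b : suc (block s w) * 4 ≤ 4 * b
    block+1≤b = ≤-trans (*-monoˡ-≤ 4 (block<b s w<b)) (≤-reflexive (*-comm b 4))

  placeSegment-valid : ∀ {seg j} → ValidSegment seg → j < width seg → ValidColumn (4 * b) (placeSegment seg j)
  placeSegment-valid {single s}        valid            j<b  = placeStrand-valid valid j<b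
  placeSegment-valid {double s s′} {j} (valid , valid′) j<2b =
    alternate-preserves {P = λ s → ValidColumn (4 * b) (placeStrand s ⌊ j /2⌋)}
      (placeStrand-valid valid ⌊j/2⌋<b) (placeStrand-valid valid′ ⌊j/2⌋<b) j
    where
    ⌊j/2⌋<b : ⌊ j /2⌋ < b
    ⌊j/2⌋<b = ⌊j/2⌋<k b j<2b

  place-valid : ∀ {ss} → All ValidSegment ss → IsPlacement (4 * b) (totalWidth ss) (place ss)
  place-valid {seg ∷ ss} (valid ∷ valids) {j} j<W with j <? width seg
  ... | yes j<w rewrite <ᵇ-true j<w = placeSegment-valid valid j<w
  ... | no  j≮w rewrite <ᵇ-false (≮⇒≥ j≮w) = place-valid valids
    (subst (j ∸ width seg <_) (m+n∸m≡n (width seg) (totalWidth ss)) (∸-monoˡ-< j<W (≮⇒≥ j≮w)))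

  module _ {t ρ : ℕ} (t<b : t < b) (ρ<4 : ρ < 4) (v : ℕ → ℕ) (σ : Sign) where
    open ℕProfile b t (b ∸ suc t) v σ ρ
    open ≡-Reasoning

    private
      r : ℕ
      r = ρ + t * 4

    strand-incidence : ∀ {s} → ValidStrand s → (F : ℕ → ℕ) →
      ∑ b (λ w → δ r (placeStrand s w σ) (F w)) ≡ δ ρ (residue σ s) (F (block s t))
    strand-incidence {s} valid F = begin
      ∑ b (λ w → δ r (residue σ s + block s w * 4) (F w))
        ≡⟨ ∑-cong b (λ w _ → δ-digits t (block s w) (F w) ρ<4 (residue<4 valid σ)) ⟩
      ∑ b (λ w → δ ρ (residue σ s) (δ t (block s w) (F w)))
        ≡⟨ ∑-δ-factor b ρ (residue σ s) _ ⟩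
      δ ρ (residue σ s) (∑ b (λ w → δ t (block s w) (F w)))
        ≡⟨ cong (δ ρ (residue σ s)) (∑-δ-involution b (block<b s) (block-involutive s) F t<b) ⟩
      δ ρ (residue σ s) (F (block s t)) ∎

    segment-incidence : ∀ {seg} → ValidSegment seg → ∀ B →
      ∑ (width seg) (λ j → δ r (placeSegment seg j σ) (v (B + j))) ≡ contribution B seg
    segment-incidence {single s}    valid            B = strand-incidence valid (λ w → v (B + w))
    segment-incidence {double s s′} (valid , valid′) B = begin
      ∑ (b * 2) f
        ≡⟨ ∑-*2 b f ⟩
      ∑ b (λ i → f (i * 2)) + ∑ b (λ i → f (suc (i * 2)))
        ≡⟨ cong₂ _+_ (∑-cong b (λ i _ → even i)) (∑-cong b (λ i _ → odd i)) ⟩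
      ∑ b (λ i → δ r (placeStrand s i σ) (v (B + i * 2)))
        + ∑ b (λ i → δ r (placeStrand s′ i σ) (v (B + suc (i * 2))))
        ≡⟨ cong₂ _+_ (strand-incidence valid _) (strand-incidence valid′ _) ⟩
      contribution B (double s s′) ∎
      where
      f : ℕ → ℕ
      f j = δ r (placeSegment (double s s′) j σ) (v (B + j))
      even : ∀ i → f (i * 2) ≡ δ r (placeStrand s i σ) (v (B + i * 2))
      even i rewrite alternate-even s s′ i | ⌊i*2/2⌋≡i i = refl
      odd : ∀ i → f (suc (i * 2)) ≡ δ r (placeStrand s′ i σ) (v (B + suc (i * 2)))
      odd i rewrite alternate-odd s s′ i | ⌊1+i*2/2⌋≡i i = refl

    place-incidence : ∀ {ss} → All ValidSegment ss → ∀ B →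
      ∑ (totalWidth ss) (λ j → δ r (place ss j σ) (v (B + j))) ≡ profile B ss
    place-incidence                []               B = refl
    place-incidence {seg ∷ ss} (valid ∷ valids) B = begin
      ∑ (width seg + totalWidth ss) g
        ≡⟨ ∑-+ (width seg) (totalWidth ss) g ⟩
      ∑ (width seg) g + ∑ (totalWidth ss) (λ i → g (width seg + i))
        ≡⟨ cong₂ _+_ (∑-cong (width seg) inSegment) (∑-cong (totalWidth ss) (λ i _ → beyondSegment i)) ⟩
      ∑ (width seg) (λ j → δ r (placeSegment seg j σ) (v (B + j)))
        + ∑ (totalWidth ss) (λ i → δ r (place ss i σ) (v (B + width seg + i)))
        ≡⟨ cong₂ _+_ (segment-incidence valid B) (place-incidence valids (B + width seg)) ⟩
      profile B (seg ∷ ss) ∎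
      where
      g : ℕ → ℕ
      g j = δ r (place (seg ∷ ss) j σ) (v (B + j))
      inSegment : ∀ j → j < width seg → g j ≡ δ r (placeSegment seg j σ) (v (B + j))
      inSegment j j<w rewrite <ᵇ-true j<w = refl
      beyondSegment : ∀ i → g (width seg + i) ≡ δ r (place ss i σ) (v (B + width seg + i))
      beyondSegment i rewrite <ᵇ-false (m≤m+n (width seg) i) | m+n∸m≡n (width seg) i | +-assoc B (width seg) i
        = refl

  quotient<b : ∀ {r} → r < 4 * b → r / 4 < b
  quotient<b {r} r<4b = m<n*o⇒m/o<n (subst (r <_) (*-comm 4 b) r<4b)

  row-incidence : ∀ {ss} → All ValidSegment ss → ∀ v σ {r} → r < 4 * b →
    ∑ (totalWidth ss) (λ c → δ r (place ss c σ) (v c))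
      ≡ ℕProfile.profile b (r / 4) (b ∸ suc (r / 4)) v σ (r % 4) 0 ss
  row-incidence {ss} valids v σ {r} r<4b =
    subst (λ r′ → ∑ (totalWidth ss) (λ c → δ r′ (place ss c σ) (v c)) ≡ profile)
      (sym (m≡m%n+[m/n]*n r 4))
      (place-incidence (quotient<b r<4b) (m%n<n r 4) v σ valids 0)
    where
    profile : ℕ
    profile = ℕProfile.profile b (r / 4) (b ∸ suc (r / 4)) v σ (r % 4) 0 ss

-- Row profiles

rowValues : (b x y : ℕ) → Sign → ℕ → ℕ → List Segment → ℕ
rowValues b x y = ℕProfile.profile b x y suc

rowEntries : (b x y ρ B : ℕ) → List Segment → ℕ
rowEntries b x y ρ B ss = entries Sign.+ + entries Sign.-
  where
  entries : Sign → ℕ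
  entries σ = ℕProfile.profile b x y (λ _ → 1) σ ρ B ss

profile-++ : ∀ b x y v σ ρ B xs ys → let open ℕProfile b x y v σ ρ in
  profile B (xs ++ ys) ≡ profile B xs + profile (B + Layout.totalWidth b xs) ys
profile-++ b x y v σ ρ B []       ys = cong (λ B′ → profile B′ ys) (sym (+-identityʳ B))
  where open ℕProfile b x y v σ ρ
profile-++ b x y v σ ρ B (s ∷ xs) ys = begin
  contribution B s + profile (B + width s) (xs ++ ys)
    ≡⟨ cong (contribution B s +_) (profile-++ b x y v σ ρ (B + width s) xs ys) ⟩
  contribution B s + (profile (B + width s) xs + profile (B + width s + totalWidth xs) ys)
    ≡⟨ sym (+-assoc (contribution B s) _ _) ⟩
  profile B (s ∷ xs) + profile (B + width s + totalWidth xs) ys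
    ≡⟨ cong (λ B′ → profile B (s ∷ xs) + profile B′ ys) (+-assoc B (width s) (totalWidth xs)) ⟩
  profile B (s ∷ xs) + profile (B + totalWidth (s ∷ xs)) ys ∎
  where
  open ℕProfile b x y v σ ρ
  open Layout b using (width; totalWidth)
  open ≡-Reasoning

rowEntries-++ : ∀ b x y ρ B xs ys →
  rowEntries b x y ρ B (xs ++ ys) ≡ rowEntries b x y ρ B xs + rowEntries b x y ρ (B + Layout.totalWidth b xs) ys
rowEntries-++ b x y ρ B xs ys =
  trans (cong₂ _+_ (profile-++ b x y _ Sign.+ ρ B xs ys) (profile-++ b x y _ Sign.- ρ B xs ys))
        (interchange (entries Sign.+ B xs) (entries Sign.+ B′ ys) (entries Sign.- B xs) (entries Sign.- B′ ys))
  where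
  B′ : ℕ
  B′ = B + Layout.totalWidth b xs
  entries : Sign → ℕ → List Segment → ℕ
  entries σ = ℕProfile.profile b x y (λ _ → 1) σ ρ

Balanced : (b x y B : ℕ) → List Segment → Set
Balanced b x y B ss = ∀ {ρ} → ρ < 4 → rowValues b x y Sign.+ ρ B ss ≡ rowValues b x y Sign.- ρ B ss

Balanced-++ : ∀ b x y B xs ys → Balanced b x y B xs → Balanced b x y (B + Layout.totalWidth b xs) ys →
  Balanced b x y B (xs ++ ys)
Balanced-++ b x y B xs ys balanced-xs balanced-ys {ρ} ρ<4 = begin
  rowValues b x y Sign.+ ρ B (xs ++ ys)                         ≡⟨ profile-++ b x y suc Sign.+ ρ B xs ys ⟩
  rowValues b x y Sign.+ ρ B xs + rowValues b x y Sign.+ ρ _ ys ≡⟨ cong₂ _+_ (balanced-xs ρ<4) (balanced-ys ρ<4) ⟩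
  rowValues b x y Sign.- ρ B xs + rowValues b x y Sign.- ρ _ ys ≡⟨ sym (profile-++ b x y suc Sign.- ρ B xs ys) ⟩
  rowValues b x y Sign.- ρ B (xs ++ ys)                         ∎
  where open ≡-Reasoning

below-4 : (P : ℕ → Set) → P 0 → P 1 → P 2 → P 3 → ∀ {ρ} → ρ < 4 → P ρ
below-4 P p₀ p₁ p₂ p₃ {0} _ = p₀
below-4 P p₀ p₁ p₂ p₃ {1} _ = p₁
below-4 P p₀ p₁ p₂ p₃ {2} _ = p₂
below-4 P p₀ p₁ p₂ p₃ {3} _ = p₃
below-4 P p₀ p₁ p₂ p₃ {suc (suc (suc (suc _)))} (s<s (s<s (s<s (s<s ()))))

module Symbolic where
  open +-*-Solver using (Polynomial; con; var; _:+_; _:*_; prove; ⟦_⟧; ⟦_⟧↓)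

  𝑩 𝒙 𝒚 : Polynomial 3
  𝑩 = var Fin.zero
  𝒙 = var (Fin.suc Fin.zero)
  𝒚 = var (Fin.suc (Fin.suc Fin.zero))

  rowPolynomial : Sign → ℕ → Polynomial 3 → List Segment → Polynomial 3
  rowPolynomial = Profile.profile _:+_ (con 0) (con 1) (_:* con 2) (con 1 :+ (𝒙 :+ 𝒚)) 𝒙 𝒚 (con 1 :+_)

  balanced : ∀ base ss (env : Vec ℕ 3) ρ →
    ⟦ rowPolynomial Sign.+ ρ base ss ⟧↓ env ≡ ⟦ rowPolynomial Sign.- ρ base ss ⟧↓ env →
    ⟦ rowPolynomial Sign.+ ρ base ss ⟧ env ≡ ⟦ rowPolynomial Sign.- ρ base ss ⟧ env
  balanced base ss env ρ = prove env (rowPolynomial Sign.+ ρ base ss) (rowPolynomial Sign.- ρ base ss)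

-- The core and quad templates

core : List Segment
core = double (forward 3 1) (forward 2 3) ∷ double (forward 0 1) (forward 0 2) ∷ double (backward 2 1) (forward 3 0)
     ∷ map single (forward 3 1 ∷ forward 2 0 ∷ backward 0 1 ∷ forward 0 2
                  ∷ forward 1 3 ∷ forward 2 0 ∷ backward 3 2 ∷ forward 1 3 ∷ [])

quad : List Segment
quad = map single (forward 0 1 ∷ forward 1 0 ∷ forward 1 0 ∷ forward 0 1
                  ∷ forward 2 3 ∷ forward 3 2 ∷ forward 3 2 ∷ forward 2 3 ∷ [])

core-valid : All ValidSegment core
core-valid = toWitness {a? = all? validSegment? core} _

quad-valid : All ValidSegment quad
quad-valid = toWitness {a? = all? validSegment? quad} _

core-balanced : ∀ x y → Balanced (suc (x + y)) x y 0 core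
core-balanced x y =
  let balanced = Symbolic.balanced (+-*-Solver.con 0) core (0 ∷ x ∷ y ∷ []) in
  below-4 (λ ρ → rowValues (suc (x + y)) x y Sign.+ ρ 0 core ≡ rowValues (suc (x + y)) x y Sign.- ρ 0 core)
    (balanced 0 refl) (balanced 1 refl) (balanced 2 refl) (balanced 3 refl)

quad-balanced : ∀ x y B → Balanced (suc (x + y)) x y B quad
quad-balanced x y B =
  let balanced = Symbolic.balanced Symbolic.𝑩 quad (B ∷ x ∷ y ∷ []) in
  below-4 (λ ρ → rowValues (suc (x + y)) x y Sign.+ ρ B quad ≡ rowValues (suc (x + y)) x y Sign.- ρ B quad)
    (balanced 0 refl) (balanced 1 refl) (balanced 2 refl) (balanced 3 refl)

core-entries : ∀ b x y B {ρ} → ρ < 4 → rowEntries b x y ρ B core ≡ 7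
core-entries b x y B = below-4 (λ ρ → rowEntries b x y ρ B core ≡ 7) refl refl refl refl

quad-entries : ∀ b x y B {ρ} → ρ < 4 → rowEntries b x y ρ B quad ≡ 4
quad-entries b x y B = below-4 (λ ρ → rowEntries b x y ρ B quad ≡ 4) refl refl refl refl

quads : ℕ → List Segment
quads a = concat (replicate a quad)

layout : ℕ → List Segment
layout a = core ++ quads a

layout-valid : ∀ a → All ValidSegment (layout a)
layout-valid a = All.++⁺ core-valid (All.concat⁺ (All.replicate⁺ a quad-valid))

units : Segment → ℕ
units (single _)   = 1
units (double _ _) = 2

totalWidth-units : ∀ b ss → Layout.totalWidth b ss ≡ sum (map units ss) * b
totalWidth-units b []                = refl
totalWidth-units b (single _ ∷ ss)   = cong (b +_) (totalWidth-units b ss)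
totalWidth-units b (double _ _ ∷ ss) = begin
  b * 2 + Layout.totalWidth b ss  ≡⟨ cong₂ _+_ (*-comm b 2) (totalWidth-units b ss) ⟩
  2 * b + sum (map units ss) * b  ≡⟨ sym (*-distribʳ-+ b 2 (sum (map units ss))) ⟩
  (2 + sum (map units ss)) * b    ∎
  where open ≡-Reasoning

units-quads : ∀ a → sum (map units (quads a)) ≡ a * 8
units-quads zero    = refl
units-quads (suc a) = cong (8 +_) (units-quads a)

layout-width : ∀ a b → Layout.totalWidth b (layout a) ≡ 2 * b * (4 * suc a + 3)
layout-width a b = begin
  Layout.totalWidth b (layout a)          ≡⟨ totalWidth-units b (layout a) ⟩
  (14 + sum (map units (quads a))) * b    ≡⟨ cong (λ u → (14 + u) * b) (units-quads a) ⟩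
  (14 + a * 8) * b                        ≡⟨ width-arithmetic a b ⟩
  2 * b * (4 * suc a + 3)                 ∎
  where
  open ≡-Reasoning
  width-arithmetic : ∀ a b → (14 + a * 8) * b ≡ 2 * b * (4 * suc a + 3)
  width-arithmetic = solve-∀

quads-balanced : ∀ a x y B → Balanced (suc (x + y)) x y B (quads a)
quads-balanced zero    x y B _ = refl
quads-balanced (suc a) x y B   =
  Balanced-++ (suc (x + y)) x y B quad (quads a) (quad-balanced x y B) (quads-balanced a x y _)

layout-balanced : ∀ a {b t} → t < b → Balanced b t (b ∸ suc t) 0 (layout a)
layout-balanced a {b} {t} t<b = subst (λ b′ → Balanced b′ t y 0 (layout a)) (m+[n∸m]≡n t<b)
  (Balanced-++ (suc (t + y)) t y 0 core (quads a) (core-balanced t y) (quads-balanced a t y _))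
  where
  y : ℕ
  y = b ∸ suc t

quads-entries : ∀ a b x y B {ρ} → ρ < 4 → rowEntries b x y ρ B (quads a) ≡ a * 4
quads-entries zero    b x y B     _   = refl
quads-entries (suc a) b x y B {ρ} ρ<4 =
  trans (rowEntries-++ b x y ρ B quad (quads a))
        (cong₂ _+_ (quad-entries b x y B ρ<4) (quads-entries a b x y _ ρ<4))

layout-entries : ∀ a b x y {ρ} → ρ < 4 → rowEntries b x y ρ 0 (layout a) ≡ 4 * suc a + 3
layout-entries a b x y {ρ} ρ<4 = begin
  rowEntries b x y ρ 0 (core ++ quads a)
    ≡⟨ rowEntries-++ b x y ρ 0 core (quads a) ⟩
  rowEntries b x y ρ 0 core + rowEntries b x y ρ (Layout.totalWidth b core) (quads a)
    ≡⟨ cong₂ _+_ (core-entries b x y 0 ρ<4) (quads-entries a b x y _ ρ<4) ⟩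
  7 + a * 4
    ≡⟨ entries-arithmetic a ⟩
  4 * suc a + 3 ∎
  where
  open ≡-Reasoning
  entries-arithmetic : ∀ a → 7 + a * 4 ≡ 4 * suc a + 3
  entries-arithmetic = solve-∀

layout-placement : ∀ a b → IsPlacement (4 * b) (2 * b * (4 * suc a + 3)) (Layout.place b (layout a))
layout-placement a b = subst (λ w → IsPlacement (4 * b) w (Layout.place b (layout a))) (layout-width a b)
  (Layout.place-valid b (layout-valid a))

half-size : ∀ a b → (4 * b * (4 * suc a + 3)) / 2 ≡ 2 * b * (4 * suc a + 3)
half-size a b = trans (cong (_/ 2) (doubled a b)) (m*n/n≡m (2 * b * (4 * suc a + 3)) 2)
  where
  doubled : ∀ a b → 4 * b * (4 * suc a + 3) ≡ 2 * b * (4 * suc a + 3) * 2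
  doubled = solve-∀

module LayoutArray (a b : ℕ) = PairArray (4 * b) (2 * b * (4 * suc a + 3)) (Layout.place b (layout a))

layout-row-incidence : ∀ a b v σ {r} → r < 4 * b →
  LayoutArray.incidence a b σ v r ≡ ℕProfile.profile b (r / 4) (b ∸ suc (r / 4)) v σ (r % 4) 0 (layout a)
layout-row-incidence a b v σ {r} r<4b =
  trans (cong (λ w → ∑ w (λ c → δ r (Layout.place b (layout a) c σ) (v c))) (sym (layout-width a b)))
        (Layout.row-incidence b (layout-valid a) v σ r<4b)

lemma14 : (a b : ℕ) → 1 ≤ a → 1 ≤ b →
    SMR (4 * b) (2 * b * (4 * a + 3)) (4 * a + 3) 2
lemma14 zero    b () _
lemma14 (suc a) b _ _ = array , isSMR (layout-placement a b) (half-size a b) row-entries row-balance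
  where
  open LayoutArray a b

  row-entries : ∀ r → r < 4 * b → incidence Sign.+ (λ _ → 1) r + incidence Sign.- (λ _ → 1) r ≡ 4 * suc a + 3
  row-entries r r<4b =
    trans (cong₂ _+_ (layout-row-incidence a b _ Sign.+ r<4b) (layout-row-incidence a b _ Sign.- r<4b))
          (layout-entries a b _ _ (m%n<n r 4))

  row-balance : ∀ r → r < 4 * b → incidence Sign.+ suc r ≡ incidence Sign.- suc r
  row-balance r r<4b =
    trans (layout-row-incidence a b suc Sign.+ r<4b)
          (trans (layout-balanced a (Layout.quotient<b b r<4b) (m%n<n r 4))
                 (sym (layout-row-incidence a b suc Sign.- r<4b)))
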